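{- If $G$ is a finite simple connected graph with at least two vertices, then $o(G\circ P_5)=\mathcal{S}$ and $S_{\rm MB}'(G\circ P_5)=S_{\rm MB}(G\circ P_5)=3$.
   Context: $P_5$ is the path on $5$ vertices. The lexicographic product $G\circ H$ has vertex set $V(G)\times V(H)$, with $(g,h)(g',h')$ an edge iff $gg'\in E(G)$, or $g=g'$ and $hh'\in E(H)$. A set $W\subseteq V(X)$ is a resolving set of a connected graph $X$ if for every two distinct vertices $x,y$ there is $z\in W$ with $d(x,z)\ne d(y,z)$. In the Maker-Breaker resolving game on $X$, Resolver and Spoiler alternately select unplayed vertices of $X$; Resolver wins if the vertices he selects contain a resolving set of $X$, and Spoiler wins if she selects at least one vertex of every resolving set of $X$. The R-game has Resolver moving first; the S-game has Spoiler moving first. $o(X)=\mathcal{S}$ means Spoiler has a winning strategy no matter who starts. $S_{\rm MB}(X)$ (resp. $S_{\rm MB}'(X)$) is the minimum number of moves Spoiler needs to win the R-game (resp. S-game) under optimal play of both players. -}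

module Defs where

open import Data.Nat using (ℕ; zero; suc; _<_)
open import Data.Fin using (Fin; toℕ)
import Data.Fin as Fin
open import Data.Bool using (Bool; true; false; _∨_; _∧_; if_then_else_)
open import Data.Product using (Σ; ∃; _×_; _,_)
open import Data.Product.Properties using (≡-dec)
open import Relation.Nullary using (¬_)
open import Relation.Nullary.Decidable using (⌊_⌋)
open import Relation.Binary.PropositionalEquality using (_≡_; _≢_)
open import Relation.Binary.Definitions using (DecidableEquality)
import Data.Nat as ℕ

data Walk {V : Set} (adj : V → V → Bool) : V → V → ℕ → Set where
  here : ∀ {x} → Walk adj x x zero
  step : ∀ {x y z k} → adj x y ≡ true → Walk adj y z k → Walk adj x z (suc k)

Connected : {V : Set} → (V → V → Bool) → Set
Connected {V} adj = ∀ (x y : V) → ∃ λ k → Walk adj x y k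

Dist : {V : Set} → (V → V → Bool) → V → V → ℕ → Set
Dist adj x y k = Walk adj x y k × (∀ m → m < k → ¬ Walk adj x y m)

Resolving : {V : Set} → (V → V → Bool) → (V → Bool) → Set
Resolving {V} adj W =
  ∀ (x y : V) → x ≢ y →
    ∃ λ z → W z ≡ true × ∃ λ k → Dist adj x z k × ¬ Dist adj y z k

P5 : Fin 5 → Fin 5 → Bool
P5 i j = ⌊ toℕ j ℕ.≟ suc (toℕ i) ⌋ ∨ ⌊ toℕ i ℕ.≟ suc (toℕ j) ⌋

lex : {m k : ℕ} → (Fin m → Fin m → Bool) → (Fin k → Fin k → Bool)
    → (Fin m × Fin k) → (Fin m × Fin k) → Bool
lex adjG adjH (g , h) (g' , h') = adjG g g' ∨ (⌊ g Fin.≟ g' ⌋ ∧ adjH h h')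

decFinProd : {m k : ℕ} → DecidableEquality (Fin m × Fin k)
decFinProd = ≡-dec Fin._≟_ Fin._≟_

data Cell : Set where
  free res spo : Cell

State : Set → Set
State V = V → Cell

initial : {V : Set} → State V
initial _ = free

play : {V : Set} → DecidableEquality V → State V → V → Cell → State V
play _≟_ st v c w = if ⌊ w ≟ v ⌋ then c else st w

SpoilerHasWon : {V : Set} → (V → V → Bool) → State V → Set
SpoilerHasWon {V} adj st =
  ∀ (W : V → Bool) → Resolving adj W → ∃ λ v → W v ≡ true × st v ≡ spo

mutual
  data SpoilerToMove {V : Set} (adj : V → V → Bool) (dec : DecidableEquality V)
       : ℕ → State V → Set where
    won  : ∀ {k st} → SpoilerHasWon adj st → SpoilerToMove adj dec k st
    move : ∀ {k st} (v : V) → st v ≡ free →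
           ResolverToMove adj dec k (play dec st v spo) →
           SpoilerToMove adj dec (suc k) st

  data ResolverToMove {V : Set} (adj : V → V → Bool) (dec : DecidableEquality V)
       : ℕ → State V → Set where
    won  : ∀ {k st} → SpoilerHasWon adj st → ResolverToMove adj dec k st
    move : ∀ {k st} → (∃ λ v → st v ≡ free) →
           (∀ v → st v ≡ free → SpoilerToMove adj dec k (play dec st v res)) →
           ResolverToMove adj dec k st

-- Spoiler wins the R-game (resp. S-game) within k of her moves.
SpoilerWinsR SpoilerWinsS : {V : Set} → (V → V → Bool) → DecidableEquality V → ℕ → Set
SpoilerWinsR adj dec k = ResolverToMove adj dec k initial
SpoilerWinsS adj dec k = SpoilerToMove adj dec k initial

OutcomeSpoiler : {V : Set} → (V → V → Bool) → DecidableEquality V → Set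
OutcomeSpoiler adj dec = (∃ λ k → SpoilerWinsR adj dec k) × (∃ λ k → SpoilerWinsS adj dec k)

IsMin : (ℕ → Set) → ℕ → Set
IsMin P k = P k × (∀ m → m < k → ¬ P m)

S-MB S-MB' : {V : Set} → (V → V → Bool) → DecidableEquality V → ℕ → Set
S-MB  adj dec k = IsMin (SpoilerWinsR adj dec) k
S-MB' adj dec k = IsMin (SpoilerWinsS adj dec) k

{-# OPTIONS --safe #-}
module Submission where

-- In G ∘ H a vertex (g′ , r) with g′ ≠ g is equally far from (g , p) and (g , q), and inside
-- layer g the distance is 1 or 2 according to adjacency in H.  So (g , p) and (g , q) are told
-- apart only by the vertices (g , r) with r ∈ {p , q} or r adjacent to exactly one of p , q.
-- In P₅ the pairs 01, 24, 34, 02 have the separators 012, 124, 234, 023: all contain 2, and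
-- what remains is the cycle 0 1 4 3.  Spoiler claims (g , 2) in a layer Resolver has not
-- touched, then the cycle vertex opposite Resolver's reply, then one of its two cycle
-- neighbours: three moves.  Conversely every pair x ≠ y is distinguished by x, by y and by a
-- third vertex, so two Spoiler vertices never meet every resolving set.

open import Defs
open import Data.Nat using (ℕ; zero; suc; _≤_; _<_; _+_; z≤n; s≤s; s≤s⁻¹)
open import Data.Nat.Properties
  using ( anyUpTo?; ≤-antisym; ≮⇒≥; ≤-refl; ≤-trans; ≤-<-trans
        ; m≤n⇒m≤1+n; m≤n⇒m<n∨m≡n; m≤m+n; +-suc)
open import Data.Nat.Induction using (<-rec)
open import Data.Fin using (Fin; _≟_)
import Data.Fin as Fin
open import Data.Fin.Patterns using (0F; 1F; 2F; 3F; 4F)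
open import Data.Fin.Properties using (any?; all?)
open import Data.Bool using (Bool; true; false)
import Data.Bool as Bool
open import Data.List using (List; []; _∷_; length)
open import Data.List.Membership.Propositional using (_∈_; _∉_)
import Data.List.Membership.DecPropositional as DecMembership
open import Data.List.Relation.Unary.Any using (here; there)
open import Data.Product using (∃; _×_; _,_; proj₁; proj₂)
open import Data.Sum using (_⊎_; inj₁; inj₂)
open import Data.Empty using (⊥; ⊥-elim)
open import Function using (_∘_; case_of_)
open import Relation.Unary using (Decidable)
open import Relation.Nullary using (¬_; Dec; yes; no; does)
open import Relation.Nullary.Decidable
  using (map′; from-yes; dec-true; decidable-stable; ¬?; _×-dec_; _⊎-dec_; _→-dec_)
open import Relation.Binary.PropositionalEquality using (_≡_; _≢_; refl; sym; trans; cong; subst)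
open import Relation.Binary.Definitions using (DecidableEquality)

least-witness : {P : ℕ → Set} → Decidable P → ∀ {n} → P n → ∃ (IsMin P)
least-witness {P} P? {n} = <-rec (λ n → P n → ∃ (IsMin P)) search n
  where
    search : ∀ n → (∀ {m} → m < n → P m → ∃ (IsMin P)) → P n → ∃ (IsMin P)
    search n smaller pn with anyUpTo? P? n
    ... | yes (m , m<n , pm) = smaller m<n pm
    ... | no none = n , pn , λ m m<n pm → none (m , m<n , pm)

Distinguishes : {V : Set} → (V → V → Bool) → V → V → V → Set
Distinguishes adj x y z = ∃ λ k → Dist adj x z k × ¬ Dist adj y z k

module _ {V : Set} {adj : V → V → Bool} where

  walk-zero : ∀ {x y} → Walk adj x y 0 → x ≡ y
  walk-zero here = refl

  walk-one : ∀ {x y} → Walk adj x y 1 → adj x y ≡ true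
  walk-one (step e here) = e

  dist-unique : ∀ {x z k k′} → Dist adj x z k → Dist adj x z k′ → k ≡ k′
  dist-unique (w , shortest) (w′ , shortest′) =
    ≤-antisym (≮⇒≥ λ k′<k → shortest _ k′<k w′) (≮⇒≥ λ k<k′ → shortest′ _ k<k′ w)

  dist-transport : ∀ {x y z k} →
    (∀ {n} → Walk adj x z n → ∃ λ n′ → n′ ≤ n × Walk adj y z n′) →
    (∀ {n} → Walk adj y z n → ∃ λ n′ → n′ ≤ n × Walk adj x z n′) →
    Dist adj x z k → Dist adj y z k
  dist-transport {y = y} {z} {k} x→y y→x (w , shortest) = exact (x→y w)
    where
      no-shorter : ∀ n → n < k → ¬ Walk adj y z n
      no-shorter n n<k w′ with y→x w′
      ... | n′ , n′≤n , w″ = shortest n′ (≤-<-trans n′≤n n<k) w″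

      exact : (∃ λ n → n ≤ k × Walk adj y z n) → Dist adj y z k
      exact (n , n≤k , w′) with m≤n⇒m<n∨m≡n n≤k
      ... | inj₁ n<k = ⊥-elim (no-shorter n n<k w′)
      ... | inj₂ refl = w′ , no-shorter

  connected-has-neighbour : Connected adj → (∀ x → ∃ λ y → y ≢ x) → ∀ x → ∃ λ y → adj x y ≡ true
  connected-has-neighbour conn other x with other x
  ... | y , y≢x with conn x y
  ...   | zero , here = ⊥-elim (y≢x refl)
  ...   | suc _ , step {y = z} e _ = z , e

  distinguishes-left : ∀ {x y} → x ≢ y → Distinguishes adj x y x
  distinguishes-left x≢y = 0 , (here , λ _ ()) , x≢y ∘ sym ∘ walk-zero ∘ proj₁

  distinguishes-right : ∀ {x y k} → x ≢ y → Dist adj x y k → Distinguishes adj x y y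
  distinguishes-right {k = zero} x≢y d = ⊥-elim (x≢y (walk-zero (proj₁ d)))
  distinguishes-right {k = suc k} x≢y d = suc k , d , λ d′ → proj₂ d′ 0 (s≤s z≤n) here

Searchable : Set → Set₁
Searchable V = ∀ {P : V → Set} → Decidable P → Dec (∃ P)

fin-×-searchable : ∀ {m k} → Searchable (Fin m × Fin k)
fin-×-searchable P? =
  map′ (λ (g , h , p) → (g , h) , p) (λ ((g , h) , p) → g , h , p) (any? λ g → any? λ h → P? (g , h))

module _ {V : Set} (adj : V → V → Bool) (search : Searchable V) (dec : DecidableEquality V) where

  walk? : ∀ x y n → Dec (Walk adj x y n)
  walk? x y zero = map′ (λ { refl → here }) walk-zero (dec x y)
  walk? x y (suc n) =
    map′ (λ (_ , e , w) → step e w) (λ { (step {y = z} e w) → z , e , w })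
         (search λ z → (adj x z Bool.≟ true) ×-dec walk? z y n)

  distance : Connected adj → ∀ x y → ∃ (Dist adj x y)
  distance conn x y = least-witness (walk? x y) (proj₂ (conn x y))

module _ {V : Set} (dec : DecidableEquality V) where
  open DecMembership dec using (_∈?_; _∉?_)

  Avoiding : List V → V → Bool
  Avoiding L v = does (v ∉? L)

  avoiding-∉ : ∀ {L v} → Avoiding L v ≡ true → v ∉ L
  avoiding-∉ {L} {v} avoids with v ∈? L
  ... | no v∉L = v∉L
  avoiding-∉ () | yes _

  three-in-two : ∀ {x y z : V} L → length L ≤ 2 → x ≢ y → x ≢ z → y ≢ z →
                 x ∈ L → y ∈ L → z ∈ L → ⊥
  three-in-two (_ ∷ _ ∷ _ ∷ _) (s≤s (s≤s ()))
  three-in-two (_ ∷ _) _ x≢y _ _ (here refl) (here refl) _ = x≢y refl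
  three-in-two (_ ∷ _ ∷ []) _ _ x≢z _ (here refl) (there (here refl)) (here refl) = x≢z refl
  three-in-two (_ ∷ _ ∷ []) _ _ _ y≢z (here refl) (there (here refl)) (there (here refl)) = y≢z refl
  three-in-two (_ ∷ _ ∷ []) _ _ _ y≢z (there (here refl)) (here refl) (here refl) = y≢z refl
  three-in-two (_ ∷ _ ∷ []) _ _ x≢z _ (there (here refl)) (here refl) (there (here refl)) = x≢z refl
  three-in-two (_ ∷ _ ∷ []) _ x≢y _ _ (there (here refl)) (there (here refl)) _ = x≢y refl

  one-of-three-avoids : ∀ {P : V → Set} {x y z} L → length L ≤ 2 → x ≢ y → x ≢ z → y ≢ z →
                        P x → P y → P z → ∃ λ w → Avoiding L w ≡ true × P w
  one-of-three-avoids {x = x} {y} {z} L len x≢y x≢z y≢z px py pz with x ∈? L | y ∈? L | z ∈? L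
  ... | no x∉L | _ | _ = x , dec-true (x ∉? L) x∉L , px
  ... | yes _ | no y∉L | _ = y , dec-true (y ∉? L) y∉L , py
  ... | yes _ | yes _ | no z∉L = z , dec-true (z ∉? L) z∉L , pz
  ... | yes x∈L | yes y∈L | yes z∈L = ⊥-elim (three-in-two L len x≢y x≢z y≢z x∈L y∈L z∈L)

  avoiding-two-resolving : {adj : V → V → Bool} → (∀ x y → ∃ (Dist adj x y)) →
    (∀ {x y} → x ≢ y → ∃ λ z → x ≢ z × y ≢ z × Distinguishes adj x y z) →
    ∀ L → length L ≤ 2 → Resolving adj (Avoiding L)
  avoiding-two-resolving {adj} dist third L len x y x≢y with third x≢y | dist x y
  ... | z , x≢z , y≢z , dz | _ , dxy =
    one-of-three-avoids {P = Distinguishes adj x y} L len x≢y x≢z y≢z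
      (distinguishes-left x≢y) (distinguishes-right x≢y dxy) dz

module _ {V : Set} (dec : DecidableEquality V) where

  play-same : ∀ st v c → play dec st v c v ≡ c
  play-same st v c with dec v v
  ... | yes _ = refl
  ... | no v≢v = ⊥-elim (v≢v refl)

  play-keeps-free : ∀ {st v c w} → w ≢ v → st w ≡ free → play dec st v c w ≡ free
  play-keeps-free {v = v} {w = w} w≢v free-w with dec w v
  ... | yes w≡v = ⊥-elim (w≢v w≡v)
  ... | no _ = free-w

  Extends : State V → State V → Set
  Extends st st′ = ∀ v → st v ≡ spo → st′ v ≡ spo

  extends-play : ∀ {st v} c → st v ≡ free → Extends st (play dec st v c)
  extends-play {st} {v} c free-v w w-spo with dec w v
  ... | yes refl = case trans (sym w-spo) free-v of λ ()
  ... | no _ = w-spo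

module LowerBound {V : Set} (adj : V → V → Bool) (dec : DecidableEquality V) (m : ℕ)
  (avoiding-resolving : ∀ L → length L ≤ m → Resolving adj (Avoiding dec L)) where

  SpoilerWithin : List V → State V → Set
  SpoilerWithin L st = ∀ v → st v ≡ spo → v ∈ L

  not-won : ∀ {L st} → SpoilerWithin L st → length L ≤ m → ¬ SpoilerHasWon adj st
  not-won {L} within len has-won with has-won (Avoiding dec L) (avoiding-resolving L len)
  ... | v , avoids , claimed = avoiding-∉ dec avoids (within v claimed)

  within-play-res : ∀ {L st v} → SpoilerWithin L st → SpoilerWithin L (play dec st v res)
  within-play-res {v = v} within w w-spo with dec w v
  ... | no _ = within w w-spo
  within-play-res within w () | yes _

  within-play-spo : ∀ {L st v} → SpoilerWithin L st → SpoilerWithin (v ∷ L) (play dec st v spo)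
  within-play-spo {v = v} within w w-spo with dec w v
  ... | yes w≡v = here w≡v
  ... | no _ = there (within w w-spo)

  mutual
    resolver-survives : ∀ {L st k} → SpoilerWithin L st → length L + k ≤ m →
                        ¬ ResolverToMove adj dec k st
    resolver-survives {L} {k = k} within len (won w) =
      not-won within (≤-trans (m≤m+n (length L) k) len) w
    resolver-survives within len (move (v , free-v) reply) =
      spoiler-fails (within-play-res within) len (reply v free-v)

    spoiler-fails : ∀ {L st k} → SpoilerWithin L st → length L + k ≤ m →
                    ¬ SpoilerToMove adj dec k st
    spoiler-fails {L} {k = k} within len (won w) =
      not-won within (≤-trans (m≤m+n (length L) k) len) w
    spoiler-fails {L} {k = suc k} within len (move v _ next) =
      resolver-survives (within-play-spo within) (subst (_≤ m) (+-suc (length L) k) len) next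

  optimal-R : SpoilerWinsR adj dec (suc m) → S-MB adj dec (suc m)
  optimal-R win = win , λ k k<1+m → resolver-survives {L = []} (λ _ ()) (s≤s⁻¹ k<1+m)

  optimal-S : SpoilerWinsS adj dec (suc m) → S-MB' adj dec (suc m)
  optimal-S win = win , λ k k<1+m → spoiler-fails {L = []} (λ _ ()) (s≤s⁻¹ k<1+m)

module SpoilerStrategies {V : Set} (adj : V → V → Bool) (dec : DecidableEquality V) where

  WinningClaim : State V → V → Set
  WinningClaim st t = ∀ st′ → Extends dec st st′ → st′ t ≡ spo → SpoilerHasWon adj st′

  WinningPair : State V → V → V → Set
  WinningPair st u t = ∀ st′ → Extends dec st st′ → st′ u ≡ spo → st′ t ≡ spo → SpoilerHasWon adj st′

  winning-claim-extends : ∀ {st st₁ t} → Extends dec st st₁ → WinningClaim st t → WinningClaim st₁ t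
  winning-claim-extends ext win st′ ext′ = win st′ (λ v → ext′ v ∘ ext v)

  winning-pair-extends : ∀ {st st₁ u t} → Extends dec st st₁ → WinningPair st u t → WinningPair st₁ u t
  winning-pair-extends ext win st′ ext′ = win st′ (λ v → ext′ v ∘ ext v)

  winning-pair-sym : ∀ {st u t} → WinningPair st u t → WinningPair st t u
  winning-pair-sym win st′ ext t-spo u-spo = win st′ ext u-spo t-spo

  claim-wins : ∀ {st t k} → st t ≡ free → WinningClaim st t → SpoilerToMove adj dec (suc k) st
  claim-wins {st} {t} free-t win =
    move t free-t (won (win _ (extends-play dec spo free-t) (play-same dec st t spo)))

  double-threat : ∀ {st t₁ t₂} → st t₁ ≡ free → st t₂ ≡ free → t₁ ≢ t₂ →
                  WinningClaim st t₁ → WinningClaim st t₂ → ResolverToMove adj dec 1 st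
  double-threat {st} {t₁} {t₂} free₁ free₂ t₁≢t₂ win₁ win₂ = move (t₁ , free₁) reply
    where
      reply : ∀ v → st v ≡ free → SpoilerToMove adj dec 1 (play dec st v res)
      reply v free-v with dec t₁ v
      ... | yes refl = claim-wins (play-keeps-free dec {st} (t₁≢t₂ ∘ sym) free₂)
                                  (winning-claim-extends (extends-play dec res free-v) win₂)
      ... | no t₁≢v = claim-wins (play-keeps-free dec {st} t₁≢v free₁)
                                 (winning-claim-extends (extends-play dec res free-v) win₁)

  fork : ∀ {st u t₁ t₂} → st u ≡ free → st t₁ ≡ free → st t₂ ≡ free →
         t₁ ≢ u → t₂ ≢ u → t₁ ≢ t₂ →
         WinningPair st u t₁ → WinningPair st u t₂ → SpoilerToMove adj dec 2 st
  fork {st} {u} free-u free₁ free₂ t₁≢u t₂≢u t₁≢t₂ win₁ win₂ =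
    move u free-u (double-threat (play-keeps-free dec {st} t₁≢u free₁)
                                 (play-keeps-free dec {st} t₂≢u free₂)
                                 t₁≢t₂ (threat win₁) (threat win₂))
    where
      threat : ∀ {t} → WinningPair st u t → WinningClaim (play dec st u spo) t
      threat win st′ ext =
        win st′ (λ v → ext v ∘ extends-play dec spo free-u v) (ext u (play-same dec st u spo))

  four-cycle : ∀ {st a b c d} →
    st a ≡ free → st b ≡ free → st c ≡ free → st d ≡ free →
    a ≢ b → a ≢ c → a ≢ d → b ≢ c → b ≢ d → c ≢ d →
    WinningPair st a b → WinningPair st b c → WinningPair st c d → WinningPair st d a →
    ResolverToMove adj dec 2 st
  four-cycle {st} {a} {b} {c} {d} fa fb fc fd a≢b a≢c a≢d b≢c b≢d c≢d ab bc cd da =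
    move (a , fa) reply
    where
      free-after : ∀ {v w} → w ≢ v → st w ≡ free → play dec st v res w ≡ free
      free-after = play-keeps-free dec {st}

      after : ∀ {v u t} → st v ≡ free → WinningPair st u t → WinningPair (play dec st v res) u t
      after free-v = winning-pair-extends (extends-play dec res free-v)

      -- Spoiler claims the cycle vertex opposite v (b if v is d or off the cycle), whose two
      -- cycle neighbours are then a double threat.
      reply : ∀ v → st v ≡ free → SpoilerToMove adj dec 2 (play dec st v res)
      reply v fv with dec a v | dec b v | dec c v
      ... | yes refl | _ | _ =
        fork (free-after (a≢c ∘ sym) fc) (free-after (a≢b ∘ sym) fb) (free-after (a≢d ∘ sym) fd)
             b≢c (c≢d ∘ sym) b≢d (after fv (winning-pair-sym bc)) (after fv cd)
      ... | no a≢v | yes refl | _ =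
        fork (free-after (b≢d ∘ sym) fd) (free-after a≢v fa) (free-after (b≢c ∘ sym) fc)
             a≢d c≢d a≢c (after fv da) (after fv (winning-pair-sym cd))
      ... | no a≢v | no b≢v | yes refl =
        fork (free-after a≢v fa) (free-after b≢v fb) (free-after (c≢d ∘ sym) fd)
             (a≢b ∘ sym) (a≢d ∘ sym) b≢d (after fv ab) (after fv (winning-pair-sym da))
      ... | no a≢v | no b≢v | no c≢v =
        fork (free-after b≢v fb) (free-after a≢v fa) (free-after c≢v fc)
             a≢b (b≢c ∘ sym) a≢c (after fv (winning-pair-sym ab)) (after fv bc)

module _ {k : ℕ} where

  NoIsolatedOrUniversal : (Fin k → Fin k → Bool) → Set
  NoIsolatedOrUniversal H = ∀ b h → ∃ λ r → r ≢ h × H h r ≡ b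

  no-isolated-or-universal? : ∀ (H : Fin k → Fin k → Bool) b →
                              Dec (∀ h → ∃ λ r → r ≢ h × H h r ≡ b)
  no-isolated-or-universal? H b = all? λ h → any? λ r → ¬? (r ≟ h) ×-dec (H h r Bool.≟ b)

  TwinFree : (Fin k → Fin k → Bool) → Set
  TwinFree H = ∀ h h′ → h ≢ h′ → ∃ λ r → r ≢ h × r ≢ h′ × H h r ≢ H h′ r

  twin-free? : ∀ H → Dec (TwinFree H)
  twin-free? H = all? λ h → all? λ h′ →
    ¬? (h ≟ h′) →-dec any? λ r → ¬? (r ≟ h) ×-dec ¬? (r ≟ h′) ×-dec ¬? (H h r Bool.≟ H h′ r)

  Separates : (Fin k → Fin k → Bool) → Fin k → Fin k → Fin k → Set
  Separates H p q r = r ≡ p ⊎ r ≡ q ⊎ H p r ≢ H q r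

  separates? : ∀ H p q r → Dec (Separates H p q r)
  separates? H p q r = (r ≟ p) ⊎-dec (r ≟ q) ⊎-dec ¬? (H p r Bool.≟ H q r)

  separators-among? : ∀ H p q c u t → Dec (∀ r → Separates H p q r → r ≡ c ⊎ r ≡ u ⊎ r ≡ t)
  separators-among? H p q c u t =
    all? λ r → separates? H p q r →-dec ((r ≟ c) ⊎-dec (r ≟ u) ⊎-dec (r ≟ t))

layerDistance : Bool → ℕ
layerDistance true = 1
layerDistance false = 2

layerDistance-injective : ∀ {b b′} → layerDistance b ≡ layerDistance b′ → b ≡ b′
layerDistance-injective {true} {true} _ = refl
layerDistance-injective {false} {false} _ = refl

module LexicographicProduct {m k : ℕ} (adj : Fin m → Fin m → Bool) (H : Fin k → Fin k → Bool)
  (adj-sym : ∀ g g′ → adj g g′ ≡ adj g′ g) (adj-irrefl : ∀ g → adj g g ≡ false)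
  (conn : Connected adj) (neighbour : ∀ g → ∃ λ g′ → adj g g′ ≡ true) where

  G∘H : Fin m × Fin k → Fin m × Fin k → Bool
  G∘H = lex adj H

  open SpoilerStrategies G∘H decFinProd using (WinningPair)

  edge-across : ∀ {g g′} h h′ → adj g g′ ≡ true → G∘H (g , h) (g′ , h′) ≡ true
  edge-across h h′ e rewrite e = refl

  edge-within : ∀ g h h′ → G∘H (g , h) (g , h′) ≡ H h h′
  edge-within g h h′ rewrite adj-irrefl g with g ≟ g
  ... | yes _ = refl
  ... | no g≢g = ⊥-elim (g≢g refl)

  non-edge-across : ∀ {g g′} h h′ → g ≢ g′ → adj g g′ ≡ false → G∘H (g , h) (g′ , h′) ≡ false
  non-edge-across {g} {g′} h h′ g≢g′ e rewrite e with g ≟ g′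
  ... | yes g≡g′ = ⊥-elim (g≢g′ g≡g′)
  ... | no _ = refl

  edge-stays-or-crosses : ∀ {g g′ h h′} → G∘H (g , h) (g′ , h′) ≡ true → adj g g′ ≡ true ⊎ g ≡ g′
  edge-stays-or-crosses {g} {g′} e with adj g g′ | g ≟ g′
  ... | true | _ = inj₁ refl
  ... | false | yes g≡g′ = inj₂ g≡g′
  edge-stays-or-crosses () | false | no _

  lift-walk : ∀ {g g′ n} h → Walk adj g g′ n → Walk G∘H (g , h) (g′ , h) n
  lift-walk h here = here
  lift-walk h (step e w) = step (edge-across h h e) (lift-walk h w)

  dist-adjacent : ∀ {g h r} → h ≢ r → H h r ≡ true → Dist G∘H (g , h) (g , r) 1
  dist-adjacent {g} {h} {r} h≢r hr = step (trans (edge-within g h r) hr) here , shorter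
    where
      shorter : ∀ n → n < 1 → ¬ Walk G∘H (g , h) (g , r) n
      shorter zero _ w = h≢r (cong proj₂ (walk-zero w))
      shorter (suc _) (s≤s ())

  dist-non-adjacent : ∀ {g h r} → h ≢ r → H h r ≡ false → Dist G∘H (g , h) (g , r) 2
  dist-non-adjacent {g} {h} {r} h≢r hr with neighbour g
  ... | g′ , e =
    step (edge-across h h e) (step (edge-across h r (trans (adj-sym g′ g) e)) here) , shorter
    where
      shorter : ∀ n → n < 2 → ¬ Walk G∘H (g , h) (g , r) n
      shorter zero _ w = h≢r (cong proj₂ (walk-zero w))
      shorter 1 _ w = case trans (sym hr) (trans (sym (edge-within g h r)) (walk-one w)) of λ ()
      shorter (suc (suc _)) (s≤s (s≤s ()))

  dist-within : ∀ {g h r} → h ≢ r → Dist G∘H (g , h) (g , r) (layerDistance (H h r))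
  dist-within {h = h} {r} h≢r with H h r in hr
  ... | true = dist-adjacent h≢r hr
  ... | false = dist-non-adjacent h≢r hr

  dist-within-agreeing : ∀ {g p q r n} → r ≢ p → r ≢ q → H p r ≡ H q r →
                         Dist G∘H (g , p) (g , r) n → Dist G∘H (g , q) (g , r) n
  dist-within-agreeing {g} {q = q} {r} r≢p r≢q agree d =
    subst (Dist G∘H (g , q) (g , r))
          (sym (trans (dist-unique d (dist-within (r≢p ∘ sym))) (cong layerDistance agree)))
          (dist-within (r≢q ∘ sym))

  leave-layer : ∀ {g p z n} → Walk G∘H (g , p) z n → proj₁ z ≢ g →
                ∀ q → ∃ λ n′ → n′ ≤ n × Walk G∘H (g , q) z n′
  leave-layer here z≢g q = ⊥-elim (z≢g refl)
  leave-layer {n = suc n} (step {y = _ , p₁} e w) z≢g q with edge-stays-or-crosses e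
  ... | inj₁ crosses = suc n , ≤-refl , step (edge-across q p₁ crosses) w
  ... | inj₂ refl with leave-layer w z≢g q
  ...   | n′ , n′≤n , w′ = n′ , m≤n⇒m≤1+n n′≤n , w′

  dist-across : ∀ {g p q z n} → proj₁ z ≢ g → Dist G∘H (g , p) z n → Dist G∘H (g , q) z n
  dist-across z≢g = dist-transport (λ w → leave-layer w z≢g _) (λ w → leave-layer w z≢g _)

  connected : Connected G∘H
  connected (g , h) (g′ , h′) with conn g g′
  ... | suc n , step e w = suc n , step (edge-across h h′ e) (lift-walk h′ w)
  ... | zero , here with h ≟ h′
  ...   | yes refl = 0 , here
  ...   | no h≢h′ = _ , proj₁ (dist-within h≢h′)

  distinguish-within : TwinFree H → ∀ {g h h′} → h ≢ h′ →
                       ∃ λ r → r ≢ h × r ≢ h′ × Distinguishes G∘H (g , h) (g , h′) (g , r)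
  distinguish-within twin-free {g} {h} {h′} h≢h′ with twin-free h h′ h≢h′
  ... | r , r≢h , r≢h′ , differ =
    r , r≢h , r≢h′ , _ , dist-within (r≢h ∘ sym) ,
    λ d → differ (layerDistance-injective (dist-unique d (dist-within (r≢h′ ∘ sym))))

  distinguish-across : NoIsolatedOrUniversal H → ∀ {g g′ h h′} → g ≢ g′ →
                       ∃ λ r → r ≢ h × Distinguishes G∘H (g , h) (g′ , h′) (g , r)
  distinguish-across no-iso {g} {g′} {h} {h′} g≢g′ with adj g′ g in e
  ... | true with no-iso false h
  ...   | r , r≢h , hr =
    r , r≢h , 2 , dist-non-adjacent (r≢h ∘ sym) hr ,
    λ d → proj₂ d 1 ≤-refl (step (edge-across h′ r e) here)
  distinguish-across no-iso {g} {g′} {h} {h′} g≢g′ | false with no-iso true h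
  ...   | r , r≢h , hr =
    r , r≢h , 1 , dist-adjacent (r≢h ∘ sym) hr ,
    λ d → case trans (sym (walk-one (proj₁ d))) (non-edge-across h′ r (g≢g′ ∘ sym) e) of λ ()

  third-distinguisher : NoIsolatedOrUniversal H → TwinFree H → ∀ {x y} → x ≢ y →
                        ∃ λ z → x ≢ z × y ≢ z × Distinguishes G∘H x y z
  third-distinguisher no-iso twin-free {g , h} {g′ , h′} x≢y with g ≟ g′
  ... | yes refl with distinguish-within twin-free (x≢y ∘ cong (g ,_))
  ...   | r , r≢h , r≢h′ , dz = (g , r) , r≢h ∘ sym ∘ cong proj₂ , r≢h′ ∘ sym ∘ cong proj₂ , dz
  third-distinguisher no-iso twin-free {g , h} {g′ , h′} x≢y | no g≢g′ with distinguish-across no-iso g≢g′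
  ...   | r , r≢h , dz = (g , r) , r≢h ∘ sym ∘ cong proj₂ , g≢g′ ∘ sym ∘ cong proj₁ , dz

  won-if-separators-claimed : ∀ {st g p q} → p ≢ q → (∀ r → Separates H p q r → st (g , r) ≡ spo) →
                              SpoilerHasWon G∘H st
  won-if-separators-claimed {st} {g} {p} {q} p≢q claimed W resolving
    with resolving (g , p) (g , q) (p≢q ∘ cong proj₂)
  ... | (g′ , r) , r∈W , n , d₁ , ¬d₂ with g′ ≟ g
  ...   | no g′≢g = ⊥-elim (¬d₂ (dist-across g′≢g d₁))
  ...   | yes refl with separates? H p q r
  ...     | yes sep = (g , r) , r∈W , claimed r sep
  ...     | no ¬sep = ⊥-elim (¬d₂ (dist-within-agreeing (¬sep ∘ inj₁) (¬sep ∘ inj₂ ∘ inj₁)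
                                     (decidable-stable (H p r Bool.≟ H q r) (¬sep ∘ inj₂ ∘ inj₂)) d₁))

  pair-wins : ∀ {st g c u t p q} → st (g , c) ≡ spo → p ≢ q →
              (∀ r → Separates H p q r → r ≡ c ⊎ r ≡ u ⊎ r ≡ t) → WinningPair st (g , u) (g , t)
  pair-wins {g = g} c-spo p≢q among st′ ext u-spo t-spo = won-if-separators-claimed p≢q claimed
    where
      claimed : ∀ r → Separates H _ _ r → st′ (g , r) ≡ spo
      claimed r sep with among r sep
      ... | inj₁ refl = ext _ c-spo
      ... | inj₂ (inj₁ refl) = u-spo
      ... | inj₂ (inj₂ refl) = t-spo

p5-no-isolated-or-universal : NoIsolatedOrUniversal P5
p5-no-isolated-or-universal true = from-yes (no-isolated-or-universal? P5 true)
p5-no-isolated-or-universal false = from-yes (no-isolated-or-universal? P5 false)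

p5-twin-free : TwinFree P5
p5-twin-free = from-yes (twin-free? P5)

module LexicographicProductWithP5 {n : ℕ} (adj : Fin n → Fin n → Bool)
  (adj-sym : ∀ g g′ → adj g g′ ≡ adj g′ g) (adj-irrefl : ∀ g → adj g g ≡ false)
  (conn : Connected adj) (another-layer : (g : Fin n) → ∃ λ g′ → g′ ≢ g) where

  open LexicographicProduct adj P5 adj-sym adj-irrefl conn
                            (connected-has-neighbour conn another-layer) public
  open SpoilerStrategies G∘H decFinProd

  layer-strategy : ∀ {st g} → st (g , 2F) ≡ spo → (∀ r → r ≢ 2F → st (g , r) ≡ free) →
                   ResolverToMove G∘H decFinProd 2 st
  layer-strategy holds-2 untouched =
    four-cycle (untouched 0F (λ ())) (untouched 1F (λ ())) (untouched 4F (λ ())) (untouched 3F (λ ()))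
               (λ ()) (λ ()) (λ ()) (λ ()) (λ ()) (λ ())
               (pair-wins holds-2 (λ ()) (from-yes (separators-among? P5 0F 1F 2F 0F 1F)))
               (pair-wins holds-2 (λ ()) (from-yes (separators-among? P5 2F 4F 2F 1F 4F)))
               (pair-wins holds-2 (λ ()) (from-yes (separators-among? P5 3F 4F 2F 4F 3F)))
               (pair-wins holds-2 (λ ()) (from-yes (separators-among? P5 0F 2F 2F 3F 0F)))

  open-layer : ∀ {st} g → (∀ r → st (g , r) ≡ free) → SpoilerToMove G∘H decFinProd 3 st
  open-layer {st} g untouched =
    move (g , 2F) (untouched 2F)
         (layer-strategy (play-same decFinProd st (g , 2F) spo)
                         (λ r r≢2 → play-keeps-free decFinProd {st} (r≢2 ∘ cong proj₂) (untouched r)))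

  spoiler-wins-S : Fin n → SpoilerWinsS G∘H decFinProd 3
  spoiler-wins-S g = open-layer g λ _ → refl

  spoiler-wins-R : Fin n → SpoilerWinsR G∘H decFinProd 3
  spoiler-wins-R g = move ((g , 0F) , refl) λ v _ →
    let (g′ , g′≢g) = another-layer (proj₁ v) in
    open-layer g′ λ r → play-keeps-free decFinProd {initial} (g′≢g ∘ cong proj₁) refl

  avoiding-two-resolving-G∘P5 : ∀ L → length L ≤ 2 → Resolving G∘H (Avoiding decFinProd L)
  avoiding-two-resolving-G∘P5 =
    avoiding-two-resolving decFinProd (distance G∘H fin-×-searchable decFinProd connected)
                           (third-distinguisher p5-no-isolated-or-universal p5-twin-free)

another : ∀ {n} (i : Fin (suc (suc n))) → ∃ λ j → j ≢ i
another 0F = 1F , λ ()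
another (Fin.suc _) = 0F , λ ()

theorem5p3 : (n : ℕ) → 2 ≤ n → (adj : Fin n → Fin n → Bool) →
    (∀ i j → adj i j ≡ adj j i) → (∀ i → adj i i ≡ false) → Connected adj →
    OutcomeSpoiler (lex adj P5) decFinProd
      × S-MB' (lex adj P5) decFinProd 3
      × S-MB (lex adj P5) decFinProd 3
theorem5p3 (suc (suc n)) _ adj adj-sym adj-irrefl conn =
  ((3 , wins-R) , (3 , wins-S)) , optimal-S wins-S , optimal-R wins-R
  where
    open LexicographicProductWithP5 adj adj-sym adj-irrefl conn another
    open LowerBound G∘H decFinProd 2 avoiding-two-resolving-G∘P5

    wins-R : SpoilerWinsR G∘H decFinProd 3
    wins-R = spoiler-wins-R 0F

    wins-S : SpoilerWinsS G∘H decFinProd 3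
    wins-S = spoiler-wins-S 0F
theorem5p3 (suc zero) (s≤s ())
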